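{- Let $m \geq 3$ and $n = 2$. Let $A$ be the constraint matrix of the fixed-support Wasserstein barycenter linear program written as $A\,(\mathrm{vec}(X_1);\dots;\mathrm{vec}(X_m)) = ((-1)^1u_1;\,(-1)^2u_2;\dots;(-1)^m u_m;\,\mathbf{0}_n;\dots;\mathbf{0}_n)$, $X_k\ge 0$, as described in the context. Then $A$ is equivalent to a totally unimodular matrix: after removing a suitable set of redundant rows of $A$ (rows that are linear combinations of the remaining rows, so that the set of solutions of the linear system is unchanged), the resulting matrix is totally unimodular.
   Context: Fixed-support Wasserstein barycenter problem: given $m$ probability vectors $u_1,\dots,u_m \in \Delta^n=\{v\in\mathbb{R}^n_+:\mathbf{1}_n^\top v=1\}$ and nonnegative cost matrices $C_1,\dots,C_m\in\mathbb{R}_+^{n\times n}$, minimize $\sum_{k=1}^m \langle C_k, X_k\rangle$ over $X_1,\dots,X_m\in\mathbb{R}_+^{n\times n}$ subject to $X_k\mathbf{1}_n=u_k$ for all $k\in[m]$ and $X_{k+1}^\top\mathbf{1}_n=X_k^\top\mathbf{1}_n$ for all $k\in[m-1]$. Write $\mathrm{vec}(X)\in\mathbb{R}^{n^2}$ for the row-major vectorization $(X_{11},\dots,X_{1n},X_{21},\dots,X_{nn})$, and let $E=I_n\otimes\mathbf{1}_n^\top\in\mathbb{R}^{n\times n^2}$ and $G=\mathbf{1}_n^\top\otimes I_n\in\mathbb{R}^{n\times n^2}$ (so $E\,\mathrm{vec}(X)=X\mathbf{1}_n$ and $G\,\mathrm{vec}(X)=X^\top\mathbf{1}_n$). The constraint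 matrix $A\in\mathbb{R}^{(2m-1)n\times mn^2}$ consists of $2m-1$ block rows and $m$ block columns (each block column of width $n^2$): for $k=1,\dots,m$, block row $k$ has $(-1)^kE$ in block column $k$ and zeros elsewhere; for $k=1,\dots,m-1$, block row $m+k$ has $(-1)^{k+1}G$ in block column $k$, $(-1)^{k}G$ in block column $k+1$, and zeros elsewhere. A matrix is totally unimodular if every square submatrix has determinant in $\{ -1,0,1\}$. -}

module Defs where

open import Data.Nat as ℕ using (ℕ; zero; suc; _∸_; _≟_; _<?_)
open import Data.Fin as Fin using (Fin; zero; suc; toℕ; remQuot; punchIn)
open import Data.Product using (_×_; _,_; Σ; ∃; ∃-syntax)
open import Data.Bool using (if_then_else_; _∧_)
open import Data.Integer as ℤ using (ℤ; 0ℤ; 1ℤ; -_)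
open import Data.Rational as ℚ using (ℚ)
open import Relation.Nullary using (does; ¬_)
open import Relation.Binary.PropositionalEquality using (_≡_)

Matrix : ℕ → ℕ → Set
Matrix R C = Fin R → Fin C → ℤ

neg1^ : ℕ → ℤ
neg1^ zero = 1ℤ
neg1^ (suc j) = - neg1^ j

sumℤ : ∀ {k} → (Fin k → ℤ) → ℤ
sumℤ {zero} f = 0ℤ
sumℤ {suc k} f = f zero ℤ.+ sumℤ (λ j → f (suc j))

sumℚ : ∀ {k} → (Fin k → ℚ) → ℚ
sumℚ {zero} f = ℚ.0ℚ
sumℚ {suc k} f = f zero ℚ.+ sumℚ (λ j → f (suc j))

det : ∀ {k} → Matrix k k → ℤ
det {zero} M = 1ℤ
det {suc k} M =
  sumℤ (λ j → neg1^ (toℕ j) ℤ.* (M zero j ℤ.* det (λ a b → M (suc a) (punchIn j b))))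

StrictlyIncreasing : ∀ {k N} → (Fin k → Fin N) → Set
StrictlyIncreasing f = ∀ a b → a Fin.< b → f a Fin.< f b

TotallyUnimodular : ∀ {R C} → Matrix R C → Set
TotallyUnimodular {R} {C} M =
  ∀ (k : ℕ) (r : Fin k → Fin R) (c : Fin k → Fin C) →
  StrictlyIncreasing r → StrictlyIncreasing c →
  let d = det (λ a b → M (r a) (c b)) in
  (d ≡ - 1ℤ) Data.Sum.⊎ ((d ≡ 0ℤ) Data.Sum.⊎ (d ≡ 1ℤ))
  where import Data.Sum

-- Entry of the barycenter constraint matrix, with 0-indexed data:
--   row block b ∈ {0,…,2m-2}, row i ∈ {0,…,n-1} inside the block,
--   column block kc ∈ {0,…,m-1}, and (p , q) the position in X_{kc+1}
--   (row-major vec: column index inside the block is p*n+q).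
-- E[i,(p,q)] = [p = i],  G[i,(p,q)] = [q = i].
-- Block row b < m  (paper's k = b+1): (-1)^(b+1) E in column block b.
-- Block row b ≥ m  (paper's m+k, k = b-m+1): (-1)^(k+1) G in column block k-1 = b-m,
--                                            (-1)^k G in column block k = b-m+1.
barycenterEntry : (m b i kc p q : ℕ) → ℤ
barycenterEntry m b i kc p q =
  if does (b <? m)
  then (if does (kc ≟ b) ∧ does (p ≟ i) then neg1^ (suc b) else 0ℤ)
  else (if does (kc ≟ (b ∸ m)) ∧ does (q ≟ i) then neg1^ (suc (suc (b ∸ m)))
        else if does (kc ≟ suc (b ∸ m)) ∧ does (q ≟ i) then neg1^ (suc (b ∸ m))
        else 0ℤ)

-- The constraint matrix A ∈ ℤ^{(2m-1)n × m n²}; row index = block*n + i,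
-- column index = block*n² + (p*n + q)  (via Data.Fin.remQuot, i.e. row-major).
barycenterMatrix : (m n : ℕ) → Matrix ((2 ℕ.* m ∸ 1) ℕ.* n) (m ℕ.* (n ℕ.* n))
barycenterMatrix m n row col with remQuot {2 ℕ.* m ∸ 1} n row | remQuot {m} (n ℕ.* n) col
... | b , i | kc , pq with remQuot {n} n pq
...   | p , q = barycenterEntry m (toℕ b) (toℕ i) (toℕ kc) (toℕ p) (toℕ q)

toℚ : ℤ → ℚ
toℚ z = z ℚ./ 1

IsLinComb : ∀ {R C K} → Matrix R C → (Fin K → Fin R) → Fin R → Set
IsLinComb {R} {C} {K} M s r =
  Σ (Fin K → ℚ) λ λs → ∀ (col : Fin C) →
    toℚ (M r col) ≡ sumℚ {K} (λ j → λs j ℚ.* toℚ (M (s j) col))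

-- M is equivalent to a TU matrix by deleting redundant rows: there is a set of kept
-- rows (listed increasingly by s) such that every deleted row is a linear combination
-- of the kept rows and the kept-row submatrix is totally unimodular.
TUAfterRemovingRedundantRows : ∀ {R C} → Matrix R C → Set
TUAfterRemovingRedundantRows {R} {C} M =
  ∃[ K ] Σ (Fin K → Fin R) λ s →
    StrictlyIncreasing s ×
    (∀ r → (∀ j → ¬ (s j ≡ r)) → IsLinComb M s r) ×
    TotallyUnimodular (λ a col → M (s a) col)

module Submission where

-- Indices start at 0.  For n = 2 the two E-rows of block k sum to (-1)^(k+1) on every column
-- of X_k, and the two G-rows of coupling block g sum to (-1)^g on the columns of X_g and to
-- (-1)^(g+1) on those of X_(g+1).  So these six rows sum to zero, and the second G-row of each
-- coupling block can be removed.  The remaining matrix (all E-rows and the first G-row of each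
-- coupling block) is totally unimodular: expand a square submatrix along its top row and
-- induct on its size.  If the top row is E-row ρ, it lives on columns 2ρ and 2ρ+1; column
-- 2ρ+1 vanishes in all lower rows (later E-rows live further right, kept G-rows vanish on odd
-- columns), and without it the top row has at most one nonzero entry.  If the top row is the
-- G-row of block g, all lower rows are G-rows of later blocks: an odd column is zero, a column
-- of X_g vanishes below the top, and otherwise the top row lives on columns 4(g+1) and
-- 4(g+1)+2, which are then adjacent and equal columns of the submatrix, so its determinant is 0.

open import Defs
open import Algebra.Bundles using (Semiring; Ring)
open import Data.Bool using (true; false; _∧_; if_then_else_)
import Data.Bool.Properties as Boolₚ
open import Data.Fin as Fin
  using (Fin; zero; suc; toℕ; fromℕ<; punchIn; punchOut; inject₁; remQuot)
import Data.Fin.Properties as Finₚ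
open import Data.Integer as ℤ using (ℤ; 0ℤ; 1ℤ; -_)
import Data.Integer.Properties as ℤₚ
import Data.Integer.Tactic.RingSolver as ℤSolver
open import Data.Nat
  using (ℕ; zero; suc; _+_; _*_; _∸_; _<_; _≤_; _<?_; _≟_; z<s; s<s; s≤s; s≤s⁻¹)
import Data.Nat.Properties as ℕₚ
import Data.Nat.Tactic.RingSolver as ℕSolver
open import Data.Product using (_×_; _,_; ∃-syntax; proj₁; proj₂)
open import Data.Rational as ℚ using (ℚ; 0ℚ)
import Data.Rational.Properties as ℚₚ
open import Data.Rational.Unnormalised as ℚᵘ using (mkℚᵘ; *≡*)
import Data.Rational.Unnormalised.Properties as ℚᵘₚ
open import Data.Sum using (_⊎_; inj₁; inj₂)
open import Data.Vec.Functional using (removeAt)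
open import Function using (_∘_)
open import Relation.Binary using (tri<; tri≈; tri>)
open import Relation.Binary.PropositionalEquality
open import Relation.Nullary using (¬_; yes; no; does)
open import Relation.Nullary.Decidable using (dec-true; dec-false)
open import Relation.Nullary.Negation using (contradiction)

module SemiringSums {c ℓ} (R : Semiring c ℓ) where

  open Semiring R using (Carrier; _≈_; 0#; +-cong; +-congˡ; +-identityˡ; +-identityʳ)
    renaming (_+_ to _⊕_; refl to ≈-refl; trans to ≈-trans)
  open import Algebra.Properties.Semiring.Sum R public
  open import Relation.Binary.Reasoning.Setoid (Semiring.setoid R)

  sum-zero : ∀ {k} (f : Fin k → Carrier) → (∀ j → f j ≈ 0#) → sum f ≈ 0#
  sum-zero {zero}  f f≈0 = ≈-refl
  sum-zero {suc k} f f≈0 =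
    ≈-trans (+-cong (f≈0 zero) (sum-zero (f ∘ suc) (f≈0 ∘ suc))) (+-identityˡ 0#)

  sum-single : ∀ {k} (f : Fin k → Carrier) x → (∀ j → j ≢ x → f j ≈ 0#) → sum f ≈ f x
  sum-single {suc k} f x f≈0 = begin
    sum f                    ≈⟨ sum-remove {i = x} f ⟩
    f x ⊕ sum (removeAt f x) ≈⟨ +-congˡ (sum-zero _ (λ j → f≈0 _ (Finₚ.punchInᵢ≢i x j))) ⟩
    f x ⊕ 0#                 ≈⟨ +-identityʳ (f x) ⟩
    f x                      ∎

  sum-pair : ∀ {k} (f : Fin k → Carrier) {x y} → x ≢ y →
             (∀ j → j ≢ x → j ≢ y → f j ≈ 0#) → sum f ≈ f x ⊕ f y
  sum-pair {suc k} f {x} {y} x≢y f≈0 = begin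
    sum f                              ≈⟨ sum-remove {i = x} f ⟩
    f x ⊕ sum (removeAt f x)           ≈⟨ +-congˡ (sum-single _ (punchOut x≢y) λ j j≢ →
                                            f≈0 _ (Finₚ.punchInᵢ≢i x j) (j≢ ∘ punchIn≡y j)) ⟩
    f x ⊕ f (punchIn x (punchOut x≢y)) ≡⟨ cong (λ z → f x ⊕ f z) (Finₚ.punchIn-punchOut x≢y) ⟩
    f x ⊕ f y                          ∎
    where
    punchIn≡y : ∀ j → punchIn x j ≡ y → j ≡ punchOut x≢y
    punchIn≡y j e = Finₚ.punchIn-injective x _ _ (trans e (sym (Finₚ.punchIn-punchOut x≢y)))

module ℤSums = SemiringSums ℤₚ.+-*-semiring
module ℚSums = SemiringSums (Ring.semiring ℚₚ.+-*-ring)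

sumℤ≡sum : ∀ {k} (f : Fin k → ℤ) → sumℤ f ≡ ℤSums.sum f
sumℤ≡sum {zero}  f = refl
sumℤ≡sum {suc k} f = cong (λ s → f zero ℤ.+ s) (sumℤ≡sum (f ∘ suc))

sumℤ-cong : ∀ {k} {f g : Fin k → ℤ} → (∀ j → f j ≡ g j) → sumℤ f ≡ sumℤ g
sumℤ-cong {zero}  f≡g = refl
sumℤ-cong {suc k} f≡g = cong₂ ℤ._+_ (f≡g zero) (sumℤ-cong (f≡g ∘ suc))

sumℚ≡sum : ∀ {k} (f : Fin k → ℚ) → sumℚ f ≡ ℚSums.sum f
sumℚ≡sum {zero}  f = refl
sumℚ≡sum {suc k} f = cong (λ s → f zero ℚ.+ s) (sumℚ≡sum (f ∘ suc))

minor : ∀ {k} → Matrix (suc k) (suc k) → Fin (suc k) → Matrix k k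
minor M j a b = M (suc a) (punchIn j b)

laplaceTerm : ∀ {k} → Matrix (suc k) (suc k) → Fin (suc k) → ℤ
laplaceTerm M j = neg1^ (toℕ j) ℤ.* (M zero j ℤ.* det (minor M j))

det-expand : ∀ {k} (M : Matrix (suc k) (suc k)) → det M ≡ ℤSums.sum (laplaceTerm M)
det-expand M = sumℤ≡sum (laplaceTerm M)

laplaceTerm-zero : ∀ {k} (M : Matrix (suc k) (suc k)) j →
                   M zero j ≡ 0ℤ ⊎ det (minor M j) ≡ 0ℤ → laplaceTerm M j ≡ 0ℤ
laplaceTerm-zero M j (inj₁ Mj≡0) rewrite Mj≡0 = ℤₚ.*-zeroʳ (neg1^ (toℕ j))
laplaceTerm-zero M j (inj₂ d≡0) rewrite d≡0 | ℤₚ.*-zeroʳ (M zero j) = ℤₚ.*-zeroʳ (neg1^ (toℕ j))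

minor-punchOut : ∀ {k} (M : Matrix (suc k) (suc k)) {j p} (j≢p : j ≢ p) a →
                 minor M j a (punchOut j≢p) ≡ M (suc a) p
minor-punchOut M j≢p a = cong (M (suc a)) (Finₚ.punchIn-punchOut j≢p)

det-cong : ∀ {k} {M N : Matrix k k} → (∀ a b → M a b ≡ N a b) → det M ≡ det N
det-cong {zero}  M≡N = refl
det-cong {suc k} M≡N = sumℤ-cong λ j → cong₂ (λ x d → neg1^ (toℕ j) ℤ.* (x ℤ.* d))
  (M≡N zero j) (det-cong (λ a b → M≡N (suc a) (punchIn j b)))

det-zero-column : ∀ {k} (M : Matrix k k) p → (∀ a → M a p ≡ 0ℤ) → det M ≡ 0ℤ
det-zero-column {suc k} M p M·p≡0 = trans (det-expand M) (ℤSums.sum-zero _ term≡0)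
  where
  term≡0 : ∀ j → laplaceTerm M j ≡ 0ℤ
  term≡0 j with j Fin.≟ p
  ... | yes refl = laplaceTerm-zero M j (inj₁ (M·p≡0 zero))
  ... | no j≢p   = laplaceTerm-zero M j (inj₂ (det-zero-column (minor M j) (punchOut j≢p)
                     λ a → trans (minor-punchOut M j≢p a) (M·p≡0 (suc a))))

det-pivot-column : ∀ {k} (M : Matrix (suc k) (suc k)) p →
                   (∀ a → M (suc a) p ≡ 0ℤ) → det M ≡ laplaceTerm M p
det-pivot-column M p below≡0 = trans (det-expand M) (ℤSums.sum-single _ p λ j j≢p →
  laplaceTerm-zero M j (inj₂ (det-zero-column (minor M j) (punchOut j≢p)
    λ a → trans (minor-punchOut M j≢p a) (below≡0 a))))

det-pivot-row : ∀ {k} (M : Matrix (suc k) (suc k)) p →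
                (∀ j → j ≢ p → M zero j ≡ 0ℤ) → det M ≡ laplaceTerm M p
det-pivot-row M p rest≡0 = trans (det-expand M) (ℤSums.sum-single _ p λ j j≢p →
  laplaceTerm-zero M j (inj₁ (rest≡0 j j≢p)))

punchIn-inject₁-suc : ∀ {a} {A : Set a} {k} (f : Fin (suc k) → A) x → f (inject₁ x) ≡ f (suc x) →
                      ∀ b → f (punchIn (inject₁ x) b) ≡ f (punchIn (suc x) b)
punchIn-inject₁-suc f zero    fx≡fsx zero    = sym fx≡fsx
punchIn-inject₁-suc f zero    fx≡fsx (suc b) = refl
punchIn-inject₁-suc f (suc x) fx≡fsx zero    = refl
punchIn-inject₁-suc f (suc x) fx≡fsx (suc b) = punchIn-inject₁-suc (f ∘ suc) x fx≡fsx b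

inject₁≢suc : ∀ {k} (x : Fin k) → inject₁ x ≢ suc x
inject₁≢suc x x≡sx = ℕₚ.1+n≢n (sym (trans (sym (Finₚ.toℕ-inject₁ x)) (cong toℕ x≡sx)))

det-twin-columns : ∀ {k} (M : Matrix (suc k) (suc k)) x →
                   (∀ j → j ≢ inject₁ x → j ≢ suc x → M zero j ≡ 0ℤ) →
                   (∀ a → M a (inject₁ x) ≡ M a (suc x)) → det M ≡ 0ℤ
det-twin-columns {k} M x rest≡0 twins = begin
  det M                                    ≡⟨ det-expand M ⟩
  ℤSums.sum term                           ≡⟨ ℤSums.sum-pair _ (inject₁≢suc x) rest-term≡0 ⟩
  term (inject₁ x) ℤ.+ term (suc x)        ≡⟨ cong (λ t → term (inject₁ x) ℤ.+ t) term-suc ⟩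
  term (inject₁ x) ℤ.+ - term (inject₁ x)  ≡⟨ ℤₚ.+-inverseʳ (term (inject₁ x)) ⟩
  0ℤ                                       ∎
  where
  open ≡-Reasoning
  term : Fin (suc k) → ℤ
  term = laplaceTerm M
  rest-term≡0 : ∀ j → j ≢ inject₁ x → j ≢ suc x → term j ≡ 0ℤ
  rest-term≡0 j j≢x j≢sx = laplaceTerm-zero M j (inj₁ (rest≡0 j j≢x j≢sx))
  minors≡ : det (minor M (suc x)) ≡ det (minor M (inject₁ x))
  minors≡ = det-cong λ a b → sym (punchIn-inject₁-suc (M (suc a)) x (twins (suc a)) b)
  σ : ℤ
  σ = neg1^ (toℕ (inject₁ x))
  term-suc : term (suc x) ≡ - term (inject₁ x)
  term-suc = begin
    - neg1^ (toℕ x) ℤ.* (M zero (suc x) ℤ.* det (minor M (suc x)))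
      ≡⟨ cong₂ (λ n y → - neg1^ n ℤ.* (y ℤ.* det (minor M (suc x))))
               (sym (Finₚ.toℕ-inject₁ x)) (sym (twins zero)) ⟩
    - σ ℤ.* (M zero (inject₁ x) ℤ.* det (minor M (suc x)))
      ≡⟨ cong (λ d → - σ ℤ.* (M zero (inject₁ x) ℤ.* d)) minors≡ ⟩
    - σ ℤ.* (M zero (inject₁ x) ℤ.* det (minor M (inject₁ x)))
      ≡⟨ ℤₚ.neg-distribˡ-* σ _ ⟨
    - term (inject₁ x) ∎

SignOrZero : ℤ → Set
SignOrZero d = d ≡ - 1ℤ ⊎ (d ≡ 0ℤ ⊎ d ≡ 1ℤ)

SignOrZero-* : ∀ {x y} → SignOrZero x → SignOrZero y → SignOrZero (x ℤ.* y)
SignOrZero-* (inj₁ refl)        (inj₁ refl)        = inj₂ (inj₂ refl)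
SignOrZero-* (inj₁ refl)        (inj₂ (inj₁ refl)) = inj₂ (inj₁ refl)
SignOrZero-* (inj₁ refl)        (inj₂ (inj₂ refl)) = inj₁ refl
SignOrZero-* (inj₂ (inj₁ refl)) _                  = inj₂ (inj₁ refl)
SignOrZero-* (inj₂ (inj₂ refl)) y                  = subst SignOrZero (sym (ℤₚ.*-identityˡ _)) y

neg1^-signOrZero : ∀ n → SignOrZero (neg1^ n)
neg1^-signOrZero zero    = inj₂ (inj₂ refl)
neg1^-signOrZero (suc n) with neg1^ n | neg1^-signOrZero n
... | _ | inj₁ refl        = inj₂ (inj₂ refl)
... | _ | inj₂ (inj₁ refl) = inj₂ (inj₁ refl)
... | _ | inj₂ (inj₂ refl) = inj₁ refl

submatrix : ∀ {R C k} → Matrix R C → (Fin k → Fin R) → (Fin k → Fin C) → Matrix k k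
submatrix M r c a b = M (r a) (c b)

StrictlyIncreasing-∘suc : ∀ {k N} {f : Fin (suc k) → Fin N} →
                          StrictlyIncreasing f → StrictlyIncreasing (f ∘ suc)
StrictlyIncreasing-∘suc f↑ a b a<b = f↑ (suc a) (suc b) (s<s a<b)

StrictlyIncreasing-∘punchIn : ∀ {k N} {f : Fin (suc k) → Fin N} →
                              StrictlyIncreasing f → ∀ p → StrictlyIncreasing (f ∘ punchIn p)
StrictlyIncreasing-∘punchIn f↑ p a b a<b = f↑ _ _ (Finₚ.≤∧≢⇒<
  (Finₚ.punchIn-mono-≤ p a b (ℕₚ.<⇒≤ a<b)) (Finₚ.<⇒≢ a<b ∘ Finₚ.punchIn-injective p a b))

data LaplaceCase {k} (S : Matrix (suc k) (suc k)) : Set where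
  pivot-column : ∀ p → (∀ a → S (suc a) p ≡ 0ℤ) → LaplaceCase S
  pivot-row    : ∀ p → (∀ j → j ≢ p → S zero j ≡ 0ℤ) → LaplaceCase S
  twin-columns : ∀ x → (∀ j → j ≢ inject₁ x → j ≢ suc x → S zero j ≡ 0ℤ) →
                 (∀ a → S a (inject₁ x) ≡ S a (suc x)) → LaplaceCase S

totallyUnimodular-byLaplace :
  ∀ {R C} (M : Matrix R C) → (∀ i j → SignOrZero (M i j)) →
  (∀ {k} (r : Fin (suc k) → Fin R) (c : Fin (suc k) → Fin C) →
     StrictlyIncreasing r → StrictlyIncreasing c → LaplaceCase (submatrix M r c)) →
  TotallyUnimodular M
totallyUnimodular-byLaplace {R} {C} M entries cases = tu
  where
  tu : TotallyUnimodular M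
  tu zero    r c r↑ c↑ = inj₂ (inj₂ refl)
  tu (suc k) r c r↑ c↑ = byCase (cases r c r↑ c↑)
    where
    S : Matrix (suc k) (suc k)
    S = submatrix M r c
    term : ∀ p → SignOrZero (laplaceTerm S p)
    term p = SignOrZero-* (neg1^-signOrZero (toℕ p)) (SignOrZero-* (entries _ _)
      (tu k (r ∘ suc) (c ∘ punchIn p) (StrictlyIncreasing-∘suc r↑) (StrictlyIncreasing-∘punchIn c↑ p)))
    byCase : LaplaceCase S → SignOrZero (det S)
    byCase (pivot-column p below≡0) = subst SignOrZero (sym (det-pivot-column S p below≡0)) (term p)
    byCase (pivot-row p rest≡0)     = subst SignOrZero (sym (det-pivot-row S p rest≡0)) (term p)
    byCase (twin-columns x rest≡0 twins) =
      subst SignOrZero (sym (det-twin-columns S x rest≡0 twins)) (inj₂ (inj₁ refl))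

module _ {k N} {f : Fin k → Fin N} (f↑ : StrictlyIncreasing f) where

  StrictlyIncreasing-reflects-< : ∀ {a b} → f a Fin.< f b → a Fin.< b
  StrictlyIncreasing-reflects-< {a} {b} fa<fb with Finₚ.<-cmp a b
  ... | tri< a<b _ _  = a<b
  ... | tri≈ _ refl _ = contradiction fa<fb (ℕₚ.<-irrefl refl)
  ... | tri> _ _ b<a  = contradiction fa<fb (ℕₚ.<-asym (f↑ b a b<a))

  StrictlyIncreasing-injective : ∀ {a b} → f a ≡ f b → a ≡ b
  StrictlyIncreasing-injective {a} {b} fa≡fb with Finₚ.<-cmp a b
  ... | tri< a<b _ _ = contradiction fa≡fb (Finₚ.<⇒≢ (f↑ a b a<b))
  ... | tri≈ _ a≡b _ = a≡b
  ... | tri> _ _ b<a = contradiction (sym fa≡fb) (Finₚ.<⇒≢ (f↑ b a b<a))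

  StrictlyIncreasing-gap : ∀ {y y′ t} → toℕ (f y) ≡ t → toℕ (f y′) ≡ 2 + t →
                           (∀ z → toℕ (f z) ≢ suc t) → toℕ y′ ≡ suc (toℕ y)
  StrictlyIncreasing-gap {y} {y′} {t} fy≡t fy′≡2+t no-middle
    with ℕₚ.m≤n⇒m<n∨m≡n (StrictlyIncreasing-reflects-< {y} {y′} fy<fy′)
    where
    fy<fy′ : toℕ (f y) < toℕ (f y′)
    fy<fy′ = subst₂ _<_ (sym fy≡t) (sym fy′≡2+t) (ℕₚ.m≤n⇒m≤1+n ℕₚ.≤-refl)
  ... | inj₂ y′≡1+y = sym y′≡1+y
  ... | inj₁ 1+y<y′ = contradiction (ℕₚ.≤-antisym (s≤s⁻¹ fz<2+t) t<fz) (no-middle z)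
    where
    z : Fin k
    z = fromℕ< (ℕₚ.<-trans 1+y<y′ (Finₚ.toℕ<n y′))
    toℕ-z : toℕ z ≡ suc (toℕ y)
    toℕ-z = Finₚ.toℕ-fromℕ< _
    t<fz : t < toℕ (f z)
    t<fz = subst (_< toℕ (f z)) fy≡t (f↑ y z (subst (toℕ y <_) (sym toℕ-z) (ℕₚ.n<1+n _)))
    fz<2+t : toℕ (f z) < 2 + t
    fz<2+t = subst (toℕ (f z) <_) fy′≡2+t (f↑ z y′ (subst (_< toℕ y′) (sym toℕ-z) 1+y<y′))

adjacent⇒inject₁-suc : ∀ {k} {y y′ : Fin (suc k)} → toℕ y′ ≡ suc (toℕ y) →
                       ∃[ x ] (inject₁ x ≡ y × suc x ≡ y′)
adjacent⇒inject₁-suc {y′ = suc x} y′≡1+y =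
  x , Finₚ.toℕ-injective (trans (Finₚ.toℕ-inject₁ x) (ℕₚ.suc-injective y′≡1+y)) , refl

module _ {k C} {S : Matrix (suc k) (suc k)} {c : Fin (suc k) → Fin C} (c↑ : StrictlyIncreasing c) where

  pivot-row-at-value : ∀ t → (∀ j → toℕ (c j) ≢ t → S zero j ≡ 0ℤ) → LaplaceCase S
  pivot-row-at-value t rest≡0 with Finₚ.any? (λ y → toℕ (c y) ≟ t)
  ... | yes (y , cy≡t) = pivot-row y λ j j≢y → rest≡0 j λ cj≡t →
        j≢y (StrictlyIncreasing-injective c↑ (Finₚ.toℕ-injective (trans cj≡t (sym cy≡t))))
  ... | no ∄y = pivot-row zero λ j _ → rest≡0 j λ cj≡t → ∄y (j , cj≡t)

  twin-columns-at-values : ∀ t → (∀ j → toℕ (c j) ≢ t → toℕ (c j) ≢ 2 + t → S zero j ≡ 0ℤ) →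
                           (∀ z → toℕ (c z) ≢ suc t) →
                           (∀ a y y′ → toℕ (c y) ≡ t → toℕ (c y′) ≡ 2 + t → S a y ≡ S a y′) →
                           LaplaceCase S
  twin-columns-at-values t rest≡0 no-middle twins
    with Finₚ.any? (λ y → toℕ (c y) ≟ t) | Finₚ.any? (λ y → toℕ (c y) ≟ 2 + t)
  ... | no ∄y | _ =
    pivot-row-at-value (2 + t) λ j cj≢2+t → rest≡0 j (λ cj≡t → ∄y (j , cj≡t)) cj≢2+t
  ... | yes _ | no ∄y′ =
    pivot-row-at-value t λ j cj≢t → rest≡0 j cj≢t (λ cj≡2+t → ∄y′ (j , cj≡2+t))
  ... | yes (y , cy≡t) | yes (y′ , cy′≡2+t)
    with adjacent⇒inject₁-suc (StrictlyIncreasing-gap c↑ cy≡t cy′≡2+t no-middle)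
  ...   | x , refl , refl = twin-columns x
          (λ j j≢y j≢y′ → rest≡0 j (j≢y ∘ same-column cy≡t) (j≢y′ ∘ same-column cy′≡2+t))
          (λ a → twins a _ _ cy≡t cy′≡2+t)
    where
    same-column : ∀ {j y v} → toℕ (c y) ≡ v → toℕ (c j) ≡ v → j ≡ y
    same-column cy≡v cj≡v =
      StrictlyIncreasing-injective c↑ (Finₚ.toℕ-injective (trans cj≡v (sym cy≡v)))

toℚ-+ : ∀ x y → toℚ (x ℤ.+ y) ≡ toℚ x ℚ.+ toℚ y
toℚ-+ x y = ℚₚ.toℚᵘ-injective (begin
  ℚ.toℚᵘ (toℚ (x ℤ.+ y))              ≈⟨ ℚₚ.toℚᵘ-fromℚᵘ (mkℚᵘ (x ℤ.+ y) 0) ⟩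
  mkℚᵘ (x ℤ.+ y) 0                    ≈⟨ *≡* (cong (ℤ._* 1ℤ) (cong₂ ℤ._+_ (sym (ℤₚ.*-identityʳ x))
                                                                       (sym (ℤₚ.*-identityʳ y)))) ⟩
  mkℚᵘ x 0 ℚᵘ.+ mkℚᵘ y 0              ≈⟨ ℚᵘₚ.+-cong (ℚᵘₚ.≃-sym (ℚₚ.toℚᵘ-fromℚᵘ (mkℚᵘ x 0)))
                                                    (ℚᵘₚ.≃-sym (ℚₚ.toℚᵘ-fromℚᵘ (mkℚᵘ y 0))) ⟩
  ℚ.toℚᵘ (toℚ x) ℚᵘ.+ ℚ.toℚᵘ (toℚ y)  ≈⟨ ℚᵘₚ.≃-sym (ℚₚ.toℚᵘ-homo-+ (toℚ x) (toℚ y)) ⟩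
  ℚ.toℚᵘ (toℚ x ℚ.+ toℚ y)            ∎)
  where open ℚᵘₚ.≃-Reasoning

toℚ-* : ∀ x y → toℚ (x ℤ.* y) ≡ toℚ x ℚ.* toℚ y
toℚ-* x y = ℚₚ.toℚᵘ-injective (begin
  ℚ.toℚᵘ (toℚ (x ℤ.* y))              ≈⟨ ℚₚ.toℚᵘ-fromℚᵘ (mkℚᵘ (x ℤ.* y) 0) ⟩
  mkℚᵘ x 0 ℚᵘ.* mkℚᵘ y 0              ≈⟨ ℚᵘₚ.*-cong (ℚᵘₚ.≃-sym (ℚₚ.toℚᵘ-fromℚᵘ (mkℚᵘ x 0)))
                                                    (ℚᵘₚ.≃-sym (ℚₚ.toℚᵘ-fromℚᵘ (mkℚᵘ y 0))) ⟩
  ℚ.toℚᵘ (toℚ x) ℚᵘ.* ℚ.toℚᵘ (toℚ y)  ≈⟨ ℚᵘₚ.≃-sym (ℚₚ.toℚᵘ-homo-* (toℚ x) (toℚ y)) ⟩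
  ℚ.toℚᵘ (toℚ x ℚ.* toℚ y)            ∎)
  where open ℚᵘₚ.≃-Reasoning

toℚ-sumℤ : ∀ {k} (f : Fin k → ℤ) → toℚ (sumℤ f) ≡ sumℚ (toℚ ∘ f)
toℚ-sumℤ {zero}  f = refl
toℚ-sumℤ {suc k} f =
  trans (toℚ-+ (f zero) _) (cong (λ s → toℚ (f zero) ℚ.+ s) (toℚ-sumℤ (f ∘ suc)))

indicator : ∀ {k} → Fin k → ℚ → Fin k → ℚ
indicator x α j = if does (j Fin.≟ x) then α else 0ℚ

sum-indicator : ∀ {k} (x : Fin k) α (v : Fin k → ℚ) →
                ℚSums.sum (λ j → indicator x α j ℚ.* v j) ≡ α ℚ.* v x
sum-indicator x α v = trans (ℚSums.sum-single _ x off) on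
  where
  off : ∀ j → j ≢ x → indicator x α j ℚ.* v j ≡ 0ℚ
  off j j≢x rewrite dec-false (j Fin.≟ x) j≢x = ℚₚ.*-zeroˡ (v j)
  on : indicator x α x ℚ.* v x ≡ α ℚ.* v x
  on rewrite dec-true (x Fin.≟ x) refl = refl

IsLinComb-fromℤ : ∀ {R C K T} (M : Matrix R C) (s : Fin K → Fin R) r (pos : Fin T → Fin K) (α : Fin T → ℤ) →
                  (∀ col → M r col ≡ sumℤ (λ t → α t ℤ.* M (s (pos t)) col)) → IsLinComb M s r
IsLinComb-fromℤ {C = C} {K} {T} M s r pos α r≡ = coefficient , λ col → begin
  toℚ (M r col)                                            ≡⟨ cong toℚ (r≡ col) ⟩
  toℚ (sumℤ (term col))                                    ≡⟨ toℚ-sumℤ (term col) ⟩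
  sumℚ (toℚ ∘ term col)                                    ≡⟨ sumℚ≡sum (toℚ ∘ term col) ⟩
  ℚSums.sum (toℚ ∘ term col)                               ≡⟨ ℚSums.sum-cong-≗ (λ t → toℚ-* (α t) _) ⟩
  ℚSums.sum (λ t → toℚ (α t) ℚ.* v col (pos t))
    ≡⟨ ℚSums.sum-cong-≗ (λ t → sum-indicator (pos t) (toℚ (α t)) (v col)) ⟨
  ℚSums.sum (λ t → ℚSums.sum (λ j → ind t j ℚ.* v col j))  ≡⟨ ℚSums.∑-comm (λ t j → ind t j ℚ.* v col j) ⟩
  ℚSums.sum (λ j → ℚSums.sum (λ t → ind t j ℚ.* v col j))
    ≡⟨ ℚSums.sum-cong-≗ (λ j → ℚSums.*-distribʳ-sum (v col j) (λ t → ind t j)) ⟨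
  ℚSums.sum (λ j → coefficient j ℚ.* v col j)              ≡⟨ sumℚ≡sum (λ j → coefficient j ℚ.* v col j) ⟨
  sumℚ (λ j → coefficient j ℚ.* v col j)                   ∎
  where
  open ≡-Reasoning
  term : Fin C → Fin T → ℤ
  term col t = α t ℤ.* M (s (pos t)) col
  v : Fin C → Fin K → ℚ
  v col j = toℚ (M (s j) col)
  ind : Fin T → Fin K → ℚ
  ind t = indicator (pos t) (toℚ (α t))
  coefficient : Fin K → ℚ
  coefficient j = ℚSums.sum (λ t → ind t j)

entry-E-on : ∀ {m b} i q → b < m → barycenterEntry m b i b i q ≡ neg1^ (suc b)
entry-E-on {m} {b} i q b<m
  rewrite dec-true (b <? m) b<m | dec-true (b ≟ b) refl | dec-true (i ≟ i) refl = refl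

entry-E-off : ∀ {m b} i kc p q → b < m → ¬ (kc ≡ b × p ≡ i) → barycenterEntry m b i kc p q ≡ 0ℤ
entry-E-off {m} {b} i kc p q b<m off with kc ≟ b
... | no kc≢b rewrite dec-true (b <? m) b<m | dec-false (kc ≟ b) kc≢b = refl
... | yes refl
  rewrite dec-true (b <? m) b<m | dec-true (b ≟ b) refl | dec-false (p ≟ i) (off ∘ (refl ,_)) = refl

entry-G-left : ∀ m g i p → barycenterEntry m (m + g) i g p i ≡ neg1^ (2 + g)
entry-G-left m g i p
  rewrite dec-false (m + g <? m) (ℕₚ.m+n≮m m g) | ℕₚ.m+n∸m≡n m g
        | dec-true (g ≟ g) refl | dec-true (i ≟ i) refl = refl

entry-G-right : ∀ m g i p → barycenterEntry m (m + g) i (suc g) p i ≡ neg1^ (suc g)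
entry-G-right m g i p
  rewrite dec-false (m + g <? m) (ℕₚ.m+n≮m m g) | ℕₚ.m+n∸m≡n m g | dec-false (suc g ≟ g) ℕₚ.1+n≢n
        | dec-true (suc g ≟ suc g) refl | dec-true (i ≟ i) refl = refl

entry-G-outside : ∀ m g i kc p q → kc ≢ g → kc ≢ suc g → barycenterEntry m (m + g) i kc p q ≡ 0ℤ
entry-G-outside m g i kc p q kc≢g kc≢1+g
  rewrite dec-false (m + g <? m) (ℕₚ.m+n≮m m g) | ℕₚ.m+n∸m≡n m g
        | dec-false (kc ≟ g) kc≢g | dec-false (kc ≟ suc g) kc≢1+g = refl

entry-G-mismatch : ∀ m g i kc p q → q ≢ i → barycenterEntry m (m + g) i kc p q ≡ 0ℤ
entry-G-mismatch m g i kc p q q≢i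
  rewrite dec-false (m + g <? m) (ℕₚ.m+n≮m m g) | ℕₚ.m+n∸m≡n m g | dec-false (q ≟ i) q≢i
        | Boolₚ.∧-zeroʳ (does (kc ≟ g)) | Boolₚ.∧-zeroʳ (does (kc ≟ suc g)) = refl

entry-G-ignores-p : ∀ m g i kc p p′ q →
                    barycenterEntry m (m + g) i kc p q ≡ barycenterEntry m (m + g) i kc p′ q
entry-G-ignores-p m g i kc p p′ q rewrite dec-false (m + g <? m) (ℕₚ.m+n≮m m g) = refl

entry-signOrZero : ∀ m b i kc p q → SignOrZero (barycenterEntry m b i kc p q)
entry-signOrZero m b i kc p q with does (b <? m)
... | true with does (kc ≟ b) ∧ does (p ≟ i)
...   | true  = neg1^-signOrZero (suc b)
...   | false = inj₂ (inj₁ refl)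
entry-signOrZero m b i kc p q | false with does (kc ≟ (b ∸ m)) ∧ does (q ≟ i)
...   | true  = neg1^-signOrZero (2 + (b ∸ m))
...   | false with does (kc ≟ suc (b ∸ m)) ∧ does (q ≟ i)
...     | true  = neg1^-signOrZero (suc (b ∸ m))
...     | false = inj₂ (inj₁ refl)

E-pair-on : ∀ {m b} (p : Fin 2) q → b < m →
            barycenterEntry m b 0 b (toℕ p) q ℤ.+ barycenterEntry m b 1 b (toℕ p) q ≡ neg1^ (suc b)
E-pair-on {b = b} zero       q b<m =
  trans (cong₂ ℤ._+_ (entry-E-on 0 q b<m) (entry-E-off 1 b 0 q b<m λ ())) (ℤₚ.+-identityʳ _)
E-pair-on {b = b} (suc zero) q b<m =
  trans (cong₂ ℤ._+_ (entry-E-off 0 b 1 q b<m λ ()) (entry-E-on 1 q b<m)) (ℤₚ.+-identityˡ _)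

E-pair-off : ∀ {m b} kc p q → b < m → kc ≢ b →
             barycenterEntry m b 0 kc p q ℤ.+ barycenterEntry m b 1 kc p q ≡ 0ℤ
E-pair-off kc p q b<m kc≢b =
  cong₂ ℤ._+_ (entry-E-off 0 kc p q b<m (kc≢b ∘ proj₁)) (entry-E-off 1 kc p q b<m (kc≢b ∘ proj₁))

G-pair : ∀ m g kc p (q : Fin 2) {v} → (∀ i → barycenterEntry m (m + g) i kc p i ≡ v) →
         barycenterEntry m (m + g) 0 kc p (toℕ q) ℤ.+ barycenterEntry m (m + g) 1 kc p (toℕ q) ≡ v
G-pair m g kc p zero       G≡v =
  trans (cong₂ ℤ._+_ (G≡v 0) (entry-G-mismatch m g 1 kc p 0 λ ())) (ℤₚ.+-identityʳ _)
G-pair m g kc p (suc zero) G≡v =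
  trans (cong₂ ℤ._+_ (entry-G-mismatch m g 0 kc p 1 λ ()) (G≡v 1)) (ℤₚ.+-identityˡ _)

module _ {m g : ℕ} (1+g<m : suc g < m) (kc : ℕ) (p q : Fin 2) where

  private
    g<m : g < m
    g<m = ℕₚ.<-trans (ℕₚ.n<1+n g) 1+g<m

    E : ℕ → ℕ → ℤ
    E b i = barycenterEntry m b i kc (toℕ p) (toℕ q)

    G : ℕ → ℤ
    G i = barycenterEntry m (m + g) i kc (toℕ p) (toℕ q)

    σ : ℤ
    σ = neg1^ (suc g)

  open ≡-Reasoning

  rows-cancel : (E g 0 ℤ.+ E g 1) ℤ.+ ((E (suc g) 0 ℤ.+ E (suc g) 1) ℤ.+ (G 0 ℤ.+ G 1)) ≡ 0ℤ
  rows-cancel with kc ≟ g | kc ≟ suc g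
  ... | yes refl | _ = begin
    (E g 0 ℤ.+ E g 1) ℤ.+ ((E (suc g) 0 ℤ.+ E (suc g) 1) ℤ.+ (G 0 ℤ.+ G 1))
      ≡⟨ cong₂ ℤ._+_ (E-pair-on p (toℕ q) g<m)
           (cong₂ ℤ._+_ (E-pair-off g (toℕ p) (toℕ q) 1+g<m (ℕₚ.1+n≢n ∘ sym))
                        (G-pair m g g (toℕ p) q (λ i → entry-G-left m g i (toℕ p)))) ⟩
    σ ℤ.+ (0ℤ ℤ.+ - σ)  ≡⟨ cong (λ x → σ ℤ.+ x) (ℤₚ.+-identityˡ (- σ)) ⟩
    σ ℤ.+ - σ           ≡⟨ ℤₚ.+-inverseʳ σ ⟩
    0ℤ                  ∎
  ... | no _ | yes refl = begin
    (E g 0 ℤ.+ E g 1) ℤ.+ ((E (suc g) 0 ℤ.+ E (suc g) 1) ℤ.+ (G 0 ℤ.+ G 1))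
      ≡⟨ cong₂ ℤ._+_ (E-pair-off (suc g) (toℕ p) (toℕ q) g<m ℕₚ.1+n≢n)
           (cong₂ ℤ._+_ (E-pair-on p (toℕ q) 1+g<m)
                        (G-pair m g (suc g) (toℕ p) q (λ i → entry-G-right m g i (toℕ p)))) ⟩
    0ℤ ℤ.+ (- σ ℤ.+ σ)  ≡⟨ ℤₚ.+-identityˡ (- σ ℤ.+ σ) ⟩
    - σ ℤ.+ σ           ≡⟨ ℤₚ.+-inverseˡ σ ⟩
    0ℤ                  ∎
  ... | no kc≢g | no kc≢1+g =
    cong₂ ℤ._+_ (E-pair-off kc (toℕ p) (toℕ q) g<m kc≢g)
      (cong₂ ℤ._+_ (E-pair-off kc (toℕ p) (toℕ q) 1+g<m kc≢1+g)
                   (G-pair m g kc (toℕ p) q λ i → entry-G-outside m g i kc (toℕ p) i kc≢g kc≢1+g))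

  G₁-combination : G 1 ≡ - 1ℤ ℤ.* E g 0 ℤ.+ (- 1ℤ ℤ.* E g 1 ℤ.+ (- 1ℤ ℤ.* E (suc g) 0 ℤ.+
                         (- 1ℤ ℤ.* E (suc g) 1 ℤ.+ (- 1ℤ ℤ.* G 0 ℤ.+ 0ℤ))))
  G₁-combination = begin
    G 1
      ≡⟨ identity e₁ e₂ e₃ e₄ e₅ (G 1) ⟩
    combination ℤ.+ ((e₁ ℤ.+ e₂) ℤ.+ ((e₃ ℤ.+ e₄) ℤ.+ (e₅ ℤ.+ G 1)))
      ≡⟨ cong (λ x → combination ℤ.+ x) rows-cancel ⟩
    combination ℤ.+ 0ℤ
      ≡⟨ ℤₚ.+-identityʳ combination ⟩
    combination
      ∎
    where
    e₁ e₂ e₃ e₄ e₅ combination : ℤ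
    e₁ = E g 0
    e₂ = E g 1
    e₃ = E (suc g) 0
    e₄ = E (suc g) 1
    e₅ = G 0
    combination = - 1ℤ ℤ.* e₁ ℤ.+ (- 1ℤ ℤ.* e₂ ℤ.+ (- 1ℤ ℤ.* e₃ ℤ.+ (- 1ℤ ℤ.* e₄ ℤ.+ (- 1ℤ ℤ.* e₅ ℤ.+ 0ℤ))))
    identity : ∀ a b c d e f →
               f ≡ (- 1ℤ ℤ.* a ℤ.+ (- 1ℤ ℤ.* b ℤ.+ (- 1ℤ ℤ.* c ℤ.+ (- 1ℤ ℤ.* d ℤ.+ (- 1ℤ ℤ.* e ℤ.+ 0ℤ)))))
                   ℤ.+ ((a ℤ.+ b) ℤ.+ ((c ℤ.+ d) ℤ.+ (e ℤ.+ f)))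
    identity = ℤSolver.solve-∀

toℕ-remQuot : ∀ {n} k (i : Fin (n * k)) →
              toℕ i ≡ k * toℕ (proj₁ (remQuot {n} k i)) + toℕ (proj₂ (remQuot {n} k i))
toℕ-remQuot {n} k i = trans (cong toℕ (sym (Finₚ.combine-remQuot {n} k i)))
                            (Finₚ.toℕ-combine (proj₁ (remQuot {n} k i)) (proj₂ (remQuot {n} k i)))

double-+-injective : ∀ {x y} (i j : Fin 2) → 2 * x + toℕ i ≡ 2 * y + toℕ j → x ≡ y × i ≡ j
double-+-injective {x} {y} zero zero e =
  ℕₚ.*-cancelˡ-≡ x y 2 (trans (sym (ℕₚ.+-identityʳ _)) (trans e (ℕₚ.+-identityʳ _))) , refl
double-+-injective {x} {y} zero (suc zero) e =
  contradiction (trans (sym (ℕₚ.+-identityʳ _)) (trans e (ℕₚ.+-comm _ 1))) (ℕₚ.even≢odd x y)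
double-+-injective {x} {y} (suc zero) zero e =
  contradiction (trans (sym (ℕₚ.+-identityʳ _)) (trans (sym e) (ℕₚ.+-comm _ 1))) (ℕₚ.even≢odd y x)
double-+-injective {x} {y} (suc zero) (suc zero) e =
  ℕₚ.*-cancelˡ-≡ x y 2 (ℕₚ.+-cancelʳ-≡ 1 _ _ e) , refl

-- Row 2b + i of the constraint matrix is row i of block row b; column 4k + 2p + q is the
-- entry (p , q) of X_k.
module Coordinates (m : ℕ) where

  rowBlock : Fin ((2 * m ∸ 1) * 2) → ℕ
  rowBlock row = toℕ (proj₁ (remQuot {2 * m ∸ 1} 2 row))

  rowPos : Fin ((2 * m ∸ 1) * 2) → Fin 2
  rowPos row = proj₂ (remQuot {2 * m ∸ 1} 2 row)

  colBlock : Fin (m * (2 * 2)) → ℕ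
  colBlock col = toℕ (proj₁ (remQuot {m} 4 col))

  colP : Fin (m * (2 * 2)) → Fin 2
  colP col = proj₁ (remQuot {2} 2 (proj₂ (remQuot {m} 4 col)))

  colQ : Fin (m * (2 * 2)) → Fin 2
  colQ col = proj₂ (remQuot {2} 2 (proj₂ (remQuot {m} 4 col)))

  colPair : Fin (m * (2 * 2)) → ℕ
  colPair col = 2 * colBlock col + toℕ (colP col)

  toℕ-row : ∀ row → toℕ row ≡ 2 * rowBlock row + toℕ (rowPos row)
  toℕ-row = toℕ-remQuot {2 * m ∸ 1} 2

  toℕ-col : ∀ col → toℕ col ≡ 2 * colPair col + toℕ (colQ col)
  toℕ-col col = begin
    toℕ col                                                   ≡⟨ toℕ-remQuot {m} 4 col ⟩
    4 * colBlock col + toℕ (proj₂ (remQuot {m} 4 col))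
      ≡⟨ cong (4 * colBlock col +_) (toℕ-remQuot {2} 2 _) ⟩
    4 * colBlock col + (2 * toℕ (colP col) + toℕ (colQ col))  ≡⟨ regroup (colBlock col) _ _ ⟩
    2 * colPair col + toℕ (colQ col)                          ∎
    where
    open ≡-Reasoning
    regroup : ∀ x y z → 4 * x + (2 * y + z) ≡ 2 * (2 * x + y) + z
    regroup = ℕSolver.solve-∀

  row-coords-unique : ∀ {row b} (i : Fin 2) → toℕ row ≡ 2 * b + toℕ i →
                      rowBlock row ≡ b × rowPos row ≡ i
  row-coords-unique {row} i row≡ = double-+-injective (rowPos row) i (trans (sym (toℕ-row row)) row≡)

  col-coords-unique : ∀ {col kc} (p q : Fin 2) → toℕ col ≡ 2 * (2 * kc + toℕ p) + toℕ q →
                      colBlock col ≡ kc × colP col ≡ p × colQ col ≡ q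
  col-coords-unique {col} p q col≡
    with double-+-injective (colQ col) q (trans (sym (toℕ-col col)) col≡)
  ... | pair≡ , q≡ with double-+-injective (colP col) p pair≡
  ...   | block≡ , p≡ = block≡ , p≡ , q≡

  column-value : ∀ col {kc} → colBlock col ≡ kc → colQ col ≡ zero →
                 toℕ col ≡ 2 * (2 * kc + toℕ (colP col)) + 0
  column-value col refl q≡0 = trans (toℕ-col col) (cong (λ q → 2 * colPair col + toℕ q) q≡0)

  column-parity : ∀ {col x} → toℕ col ≡ 2 * x + 1 → colQ col ≡ suc zero
  column-parity {col} {x} col≡ =
    proj₂ (double-+-injective {colPair col} {x} (colQ col) (suc zero) (trans (sym (toℕ-col col)) col≡))

  barycenterMatrix-at : ∀ {row b} (i : Fin 2) col → toℕ row ≡ 2 * b + toℕ i →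
                        barycenterMatrix m 2 row col ≡
                        barycenterEntry m b (toℕ i) (colBlock col) (toℕ (colP col)) (toℕ (colQ col))
  barycenterMatrix-at {row} {b} i col row≡ with row-coords-unique {row} {b} i row≡
  ... | refl , refl = refl

module KeptRows (m′ : ℕ) where

  m : ℕ
  m = suc m′

  open Coordinates m

  A : Matrix ((2 * m ∸ 1) * 2) (m * (2 * 2))
  A = barycenterMatrix m 2

  K : ℕ
  K = 2 * m + m′

  rowCount≡ : (2 * m ∸ 1) * 2 ≡ 2 * m + 2 * m′
  rowCount≡ = identity m′
    where
    identity : ∀ n → (n + suc (n + 0)) * 2 ≡ 2 * suc n + 2 * n
    identity = ℕSolver.solve-∀

  -- Kept row a < 2m is the E-row a; kept row 2m + g is the first row 2(m + g) of coupling block g.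
  keptIndex : ℕ → ℕ
  keptIndex a = a + (a ∸ 2 * m)

  keptIndex-E : ∀ {a} → a < 2 * m → keptIndex a ≡ a
  keptIndex-E {a} a<2m = trans (cong (a +_) (ℕₚ.m≤n⇒m∸n≡0 (ℕₚ.<⇒≤ a<2m))) (ℕₚ.+-identityʳ a)

  keptIndex-G : ∀ g → keptIndex (2 * m + g) ≡ 2 * (m + g) + 0
  keptIndex-G g = trans (cong (2 * m + g +_) (ℕₚ.m+n∸m≡n (2 * m) g)) (identity m g)
    where
    identity : ∀ m g → 2 * m + g + g ≡ 2 * (m + g) + 0
    identity = ℕSolver.solve-∀

  keptIndex-mono : ∀ {a b} → a < b → keptIndex a < keptIndex b
  keptIndex-mono a<b = ℕₚ.+-mono-<-≤ a<b (ℕₚ.∸-monoˡ-≤ (2 * m) (ℕₚ.<⇒≤ a<b))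

  keptIndex-< : ∀ {a} → a < K → keptIndex a < (2 * m ∸ 1) * 2
  keptIndex-< {a} a<K with a <? 2 * m
  ... | yes a<2m = begin-strict
    keptIndex a       ≡⟨ keptIndex-E a<2m ⟩
    a                 <⟨ a<2m ⟩
    2 * m             ≤⟨ ℕₚ.m≤m+n (2 * m) (2 * m′) ⟩
    2 * m + 2 * m′    ≡⟨ rowCount≡ ⟨
    (2 * m ∸ 1) * 2   ∎
    where open ℕₚ.≤-Reasoning
  ... | no a≮2m = begin-strict
    keptIndex a            ≡⟨ cong keptIndex a≡ ⟨
    keptIndex (2 * m + g)  ≡⟨ keptIndex-G g ⟩
    2 * (m + g) + 0        ≡⟨ identity m g ⟩
    2 * m + 2 * g          <⟨ ℕₚ.+-monoʳ-< (2 * m) (ℕₚ.*-monoʳ-< 2 g<m′) ⟩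
    2 * m + 2 * m′         ≡⟨ rowCount≡ ⟨
    (2 * m ∸ 1) * 2        ∎
    where
    open ℕₚ.≤-Reasoning
    g : ℕ
    g = a ∸ 2 * m
    a≡ : 2 * m + g ≡ a
    a≡ = ℕₚ.m+[n∸m]≡n (ℕₚ.≮⇒≥ a≮2m)
    g<m′ : g < m′
    g<m′ = ℕₚ.+-cancelˡ-< (2 * m) g m′ (subst (_< K) (sym a≡) a<K)
    identity : ∀ m g → 2 * (m + g) + 0 ≡ 2 * m + 2 * g
    identity = ℕSolver.solve-∀

  kept : Fin K → Fin ((2 * m ∸ 1) * 2)
  kept a = fromℕ< (keptIndex-< (Finₚ.toℕ<n a))

  toℕ-kept : ∀ a → toℕ (kept a) ≡ keptIndex (toℕ a)
  toℕ-kept a = Finₚ.toℕ-fromℕ< _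

  kept-increasing : StrictlyIncreasing kept
  kept-increasing a b a<b = subst₂ _<_ (sym (toℕ-kept a)) (sym (toℕ-kept b)) (keptIndex-mono a<b)

  kept-E : ∀ {a} → toℕ a < 2 * m → toℕ (kept a) ≡ toℕ a
  kept-E {a} a<2m = trans (toℕ-kept a) (keptIndex-E a<2m)

  G-index : Fin K → ℕ
  G-index a = toℕ a ∸ 2 * m

  kept-G : ∀ {a} → 2 * m ≤ toℕ a → toℕ (kept a) ≡ 2 * (m + G-index a) + 0
  kept-G {a} 2m≤a =
    trans (toℕ-kept a) (trans (cong keptIndex (sym (ℕₚ.m+[n∸m]≡n 2m≤a))) (keptIndex-G (G-index a)))

  A-kept-E-vanishes : ∀ {a} col → toℕ a < 2 * m → (∀ q → toℕ col ≢ 2 * toℕ a + toℕ q) →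
                      A (kept a) col ≡ 0ℤ
  A-kept-E-vanishes {a} col a<2m off =
    entry-E-off (toℕ (rowPos row)) (colBlock col) (toℕ (colP col)) (toℕ (colQ col)) b<m own
    where
    row : Fin ((2 * m ∸ 1) * 2)
    row = kept a
    a≡ : toℕ a ≡ 2 * rowBlock row + toℕ (rowPos row)
    a≡ = trans (sym (kept-E a<2m)) (toℕ-row row)
    b<m : rowBlock row < m
    b<m = ℕₚ.*-cancelˡ-< 2 _ _ (ℕₚ.≤-<-trans (ℕₚ.m≤m+n _ _) (subst (_< 2 * m) a≡ a<2m))
    own : ¬ (colBlock col ≡ rowBlock row × toℕ (colP col) ≡ toℕ (rowPos row))
    own (block≡ , p≡) = off (colQ col) (begin
      toℕ col                                                      ≡⟨ toℕ-col col ⟩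
      2 * (2 * colBlock col + toℕ (colP col)) + toℕ (colQ col)
        ≡⟨ cong₂ (λ x y → 2 * (2 * x + y) + toℕ (colQ col)) block≡ p≡ ⟩
      2 * (2 * rowBlock row + toℕ (rowPos row)) + toℕ (colQ col)  ≡⟨ cong (λ x → 2 * x + toℕ (colQ col)) a≡ ⟨
      2 * toℕ a + toℕ (colQ col)                                   ∎)
      where open ≡-Reasoning

  A-kept-G : ∀ {a} col → 2 * m ≤ toℕ a →
             A (kept a) col ≡
             barycenterEntry m (m + G-index a) 0 (colBlock col) (toℕ (colP col)) (toℕ (colQ col))
  A-kept-G {a} col 2m≤a = barycenterMatrix-at {b = m + G-index a} zero col (kept-G 2m≤a)

  A-kept-G-odd : ∀ {a} col → 2 * m ≤ toℕ a → colQ col ≡ suc zero → A (kept a) col ≡ 0ℤ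
  A-kept-G-odd {a} col 2m≤a odd = trans (A-kept-G col 2m≤a)
    (entry-G-mismatch m (G-index a) 0 (colBlock col) (toℕ (colP col)) (toℕ (colQ col))
                      (λ q≡0 → ℕₚ.0≢1+n (trans (sym q≡0) (cong toℕ odd))))

  A-kept-G-outside : ∀ {a} col → 2 * m ≤ toℕ a →
                     colBlock col ≢ G-index a → colBlock col ≢ suc (G-index a) → A (kept a) col ≡ 0ℤ
  A-kept-G-outside {a} col 2m≤a off₁ off₂ = trans (A-kept-G col 2m≤a)
    (entry-G-outside m (G-index a) 0 (colBlock col) (toℕ (colP col)) (toℕ (colQ col)) off₁ off₂)

  A-kept-G-twins : ∀ {a} col col′ → 2 * m ≤ toℕ a →
                   colBlock col ≡ colBlock col′ → colQ col ≡ colQ col′ → A (kept a) col ≡ A (kept a) col′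
  A-kept-G-twins {a} col col′ 2m≤a block≡ q≡ = begin
    A (kept a) col
      ≡⟨ A-kept-G col 2m≤a ⟩
    barycenterEntry m (m + g) 0 (colBlock col) (toℕ (colP col)) (toℕ (colQ col))
      ≡⟨ entry-G-ignores-p m g 0 (colBlock col) (toℕ (colP col)) (toℕ (colP col′)) (toℕ (colQ col)) ⟩
    barycenterEntry m (m + g) 0 (colBlock col) (toℕ (colP col′)) (toℕ (colQ col))
      ≡⟨ cong₂ (λ k q → barycenterEntry m (m + g) 0 k (toℕ (colP col′)) (toℕ q)) block≡ q≡ ⟩
    barycenterEntry m (m + g) 0 (colBlock col′) (toℕ (colP col′)) (toℕ (colQ col′))
      ≡⟨ A-kept-G col′ 2m≤a ⟨
    A (kept a) col′
      ∎
    where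
    open ≡-Reasoning
    g : ℕ
    g = G-index a

  keptMatrix : Matrix K (m * (2 * 2))
  keptMatrix a col = A (kept a) col

  module _ {k} (r : Fin (suc k) → Fin K) (c : Fin (suc k) → Fin (m * (2 * 2)))
           (r↑ : StrictlyIncreasing r) (c↑ : StrictlyIncreasing c) where

    private
      ρ : ℕ
      ρ = toℕ (r zero)

      g : ℕ
      g = G-index (r zero)

      below : ∀ a → ρ < toℕ (r (suc a))
      below a = r↑ zero (suc a) z<s

      2m≤below : 2 * m ≤ ρ → ∀ a → 2 * m ≤ toℕ (r (suc a))
      2m≤below 2m≤ρ a = ℕₚ.≤-trans 2m≤ρ (ℕₚ.<⇒≤ (below a))

      2m≤row : 2 * m ≤ ρ → ∀ a → 2 * m ≤ toℕ (r a)
      2m≤row 2m≤ρ zero    = 2m≤ρ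
      2m≤row 2m≤ρ (suc a) = 2m≤below 2m≤ρ a

      g<below : 2 * m ≤ ρ → ∀ a → g < G-index (r (suc a))
      g<below 2m≤ρ a = ℕₚ.∸-monoˡ-< (below a) 2m≤ρ

    laplaceCase-E-top : ρ < 2 * m → LaplaceCase (submatrix keptMatrix r c)
    laplaceCase-E-top ρ<2m with Finₚ.any? (λ y → toℕ (c y) ≟ 2 * ρ + 1)
    ... | yes (y , cy≡) = pivot-column y below≡0
      where
      below≡0 : ∀ a → A (kept (r (suc a))) (c y) ≡ 0ℤ
      below≡0 a with toℕ (r (suc a)) <? 2 * m
      ... | yes ρ′<2m = A-kept-E-vanishes (c y) ρ′<2m λ q cy≡′ → ℕₚ.<⇒≢ (below a)
            (proj₁ (double-+-injective {ρ} {toℕ (r (suc a))} (suc zero) q (trans (sym cy≡) cy≡′)))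
      ... | no ρ′≮2m = A-kept-G-odd (c y) (ℕₚ.≮⇒≥ ρ′≮2m) (column-parity {x = ρ} cy≡)
    ... | no ∄odd = pivot-row-at-value c↑ (2 * ρ + 0) λ j cj≢ → A-kept-E-vanishes (c j) ρ<2m λ where
      zero       → cj≢
      (suc zero) → λ cj≡ → ∄odd (j , cj≡)

    laplaceCase-G-top : 2 * m ≤ ρ → LaplaceCase (submatrix keptMatrix r c)
    laplaceCase-G-top 2m≤ρ with Finₚ.any? (λ y → colQ (c y) Fin.≟ suc zero)
    ... | yes (y , odd) = pivot-column y λ a → A-kept-G-odd (c y) (2m≤below 2m≤ρ a) odd
    ... | no ∄odd with Finₚ.any? (λ y → colBlock (c y) ≟ g)
    ...   | yes (y , block≡g) = pivot-column y λ a → A-kept-G-outside (c y) (2m≤below 2m≤ρ a)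
            (λ block≡g′ → ℕₚ.<⇒≢ (g<below 2m≤ρ a) (trans (sym block≡g) block≡g′))
            (λ block≡1+g′ → ℕₚ.<⇒≢ (ℕₚ.m<n⇒m<1+n (g<below 2m≤ρ a)) (trans (sym block≡g) block≡1+g′))
    ...   | no ∄block = twin-columns-at-values c↑ (2 * (2 * suc g)) rest≡0 no-middle twins
      where
      first-column : ∀ x → 2 * (2 * x + 0) + 0 ≡ 2 * (2 * x)
      first-column = ℕSolver.solve-∀

      second-column : ∀ x → 2 * (2 * x + 1) + 0 ≡ 2 + 2 * (2 * x)
      second-column = ℕSolver.solve-∀

      even : ∀ j → colQ (c j) ≡ zero
      even j with colQ (c j) | ∄odd ∘ (j ,_)
      ... | zero     | _    = refl
      ... | suc zero | ¬odd = contradiction refl ¬odd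

      rest≡0 : ∀ j → toℕ (c j) ≢ 2 * (2 * suc g) → toℕ (c j) ≢ 2 + 2 * (2 * suc g) →
               A (kept (r zero)) (c j) ≡ 0ℤ
      rest≡0 j ≢first ≢second = A-kept-G-outside (c j) 2m≤ρ (∄block ∘ (j ,_)) next-block
        where
        next-block : colBlock (c j) ≢ suc g
        next-block block≡ with colP (c j) | column-value (c j) block≡ (even j)
        ... | zero     | cj≡ = ≢first (trans cj≡ (first-column (suc g)))
        ... | suc zero | cj≡ = ≢second (trans cj≡ (second-column (suc g)))

      no-middle : ∀ z → toℕ (c z) ≢ suc (2 * (2 * suc g))
      no-middle z cz≡ = ∄odd (z , column-parity {x = 2 * suc g} (trans cz≡ (ℕₚ.+-comm 1 _)))

      twins : ∀ a y y′ → toℕ (c y) ≡ 2 * (2 * suc g) → toℕ (c y′) ≡ 2 + 2 * (2 * suc g) →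
              A (kept (r a)) (c y) ≡ A (kept (r a)) (c y′)
      twins a y y′ cy≡ cy′≡
        with col-coords-unique {kc = suc g} zero zero (trans cy≡ (sym (first-column (suc g))))
           | col-coords-unique {kc = suc g} (suc zero) zero (trans cy′≡ (sym (second-column (suc g))))
      ... | block≡ , _ , q≡ | block′≡ , _ , q′≡ =
        A-kept-G-twins (c y) (c y′) (2m≤row 2m≤ρ a) (trans block≡ (sym block′≡)) (trans q≡ (sym q′≡))

  keptMatrix-TU : TotallyUnimodular keptMatrix
  keptMatrix-TU = totallyUnimodular-byLaplace keptMatrix entries cases
    where
    entries : ∀ a col → SignOrZero (keptMatrix a col)
    entries a col = entry-signOrZero m (rowBlock (kept a)) (toℕ (rowPos (kept a)))
                                       (colBlock col) (toℕ (colP col)) (toℕ (colQ col))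
    cases : ∀ {k} (r : Fin (suc k) → Fin K) c → StrictlyIncreasing r → StrictlyIncreasing c →
            LaplaceCase (submatrix keptMatrix r c)
    cases r c r↑ c↑ with toℕ (r zero) <? 2 * m
    ... | yes top<2m = laplaceCase-E-top r c r↑ c↑ top<2m
    ... | no top≮2m  = laplaceCase-G-top r c r↑ c↑ (ℕₚ.≮⇒≥ top≮2m)

  double-+-< : ∀ {b} → b < m → (i : Fin 2) → 2 * b + toℕ i < 2 * m
  double-+-< {b} b<m i = begin-strict
    2 * b + toℕ i  <⟨ ℕₚ.+-monoʳ-< (2 * b) (Finₚ.toℕ<n i) ⟩
    2 * b + 2      ≡⟨ ℕₚ.+-comm (2 * b) 2 ⟩
    2 + 2 * b      ≡⟨ ℕₚ.*-suc 2 b ⟨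
    2 * suc b      ≤⟨ ℕₚ.*-monoʳ-≤ 2 b<m ⟩
    2 * m          ∎
    where open ℕₚ.≤-Reasoning

  keptE : ∀ {b} (i : Fin 2) → b < m → Fin K
  keptE i b<m = fromℕ< (ℕₚ.<-≤-trans (double-+-< b<m i) (ℕₚ.m≤m+n (2 * m) m′))

  toℕ-kept-keptE : ∀ {b} (i : Fin 2) (b<m : b < m) → toℕ (kept (keptE i b<m)) ≡ 2 * b + toℕ i
  toℕ-kept-keptE {b} i b<m = trans (kept-E (subst (_< 2 * m) (sym toℕ-keptE) (double-+-< b<m i))) toℕ-keptE
    where
    toℕ-keptE : toℕ (keptE i b<m) ≡ 2 * b + toℕ i
    toℕ-keptE = Finₚ.toℕ-fromℕ< (ℕₚ.<-≤-trans (double-+-< b<m i) (ℕₚ.m≤m+n (2 * m) m′))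

  keptG : ∀ {g} → g < m′ → Fin K
  keptG g<m′ = fromℕ< (ℕₚ.+-monoʳ-< (2 * m) g<m′)

  toℕ-kept-keptG : ∀ {g} (g<m′ : g < m′) → toℕ (kept (keptG g<m′)) ≡ 2 * (m + g) + 0
  toℕ-kept-keptG {g} g<m′ = trans (toℕ-kept (keptG g<m′))
    (trans (cong keptIndex (Finₚ.toℕ-fromℕ< (ℕₚ.+-monoʳ-< (2 * m) g<m′))) (keptIndex-G g))

  G₁-row-redundant : ∀ {g row} → g < m′ → toℕ row ≡ 2 * (m + g) + 1 → IsLinComb A kept row
  G₁-row-redundant {g} {row} g<m′ row≡ = IsLinComb-fromℤ A kept row pos (λ _ → - 1ℤ) combination
    where
    g<m : g < m
    g<m = ℕₚ.m<n⇒m<1+n g<m′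

    pos : Fin 5 → Fin K
    pos zero                         = keptE zero g<m
    pos (suc zero)                   = keptE (suc zero) g<m
    pos (suc (suc zero))             = keptE zero (s≤s g<m′)
    pos (suc (suc (suc zero)))       = keptE (suc zero) (s≤s g<m′)
    pos (suc (suc (suc (suc zero)))) = keptG g<m′

    posBlock : Fin 5 → ℕ
    posBlock zero                         = g
    posBlock (suc zero)                   = g
    posBlock (suc (suc zero))             = suc g
    posBlock (suc (suc (suc zero)))       = suc g
    posBlock (suc (suc (suc (suc zero)))) = m + g

    posRow : Fin 5 → Fin 2
    posRow zero                         = zero
    posRow (suc zero)                   = suc zero
    posRow (suc (suc zero))             = zero
    posRow (suc (suc (suc zero)))       = suc zero
    posRow (suc (suc (suc (suc zero)))) = zero

    toℕ-kept-pos : ∀ t → toℕ (kept (pos t)) ≡ 2 * posBlock t + toℕ (posRow t)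
    toℕ-kept-pos zero                         = toℕ-kept-keptE zero g<m
    toℕ-kept-pos (suc zero)                   = toℕ-kept-keptE (suc zero) g<m
    toℕ-kept-pos (suc (suc zero))             = toℕ-kept-keptE zero (s≤s g<m′)
    toℕ-kept-pos (suc (suc (suc zero)))       = toℕ-kept-keptE (suc zero) (s≤s g<m′)
    toℕ-kept-pos (suc (suc (suc (suc zero)))) = toℕ-kept-keptG g<m′

    combination : ∀ col → A row col ≡ sumℤ (λ t → - 1ℤ ℤ.* A (kept (pos t)) col)
    combination col = trans (barycenterMatrix-at {b = m + g} (suc zero) col row≡)
      (trans (G₁-combination (s≤s g<m′) (colBlock col) (colP col) (colQ col))
             (sumℤ-cong λ t → cong (- 1ℤ ℤ.*_)
               (sym (barycenterMatrix-at {b = posBlock t} (posRow t) col (toℕ-kept-pos t)))))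

  G-block-row-redundant : ∀ {g row} (i : Fin 2) → g < m′ → toℕ row ≡ 2 * (m + g) + toℕ i →
                          (∀ a → ¬ (kept a ≡ row)) → IsLinComb A kept row
  G-block-row-redundant zero g<m′ row≡ unkept =
    contradiction (Finₚ.toℕ-injective (trans (toℕ-kept-keptG g<m′) (sym row≡))) (unkept (keptG g<m′))
  G-block-row-redundant (suc zero) g<m′ row≡ unkept = G₁-row-redundant g<m′ row≡

  removed-row-redundant : ∀ row → (∀ a → ¬ (kept a ≡ row)) → IsLinComb A kept row
  removed-row-redundant row unkept with rowBlock row <? m
  ... | yes b<m = contradiction
    (Finₚ.toℕ-injective (trans (toℕ-kept-keptE (rowPos row) b<m) (sym (toℕ-row row))))
    (unkept (keptE (rowPos row) b<m))
  ... | no b≮m = G-block-row-redundant (rowPos row) g<m′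
    (trans (toℕ-row row) (cong (λ b → 2 * b + toℕ (rowPos row)) (sym block≡))) unkept
    where
    block≡ : m + (rowBlock row ∸ m) ≡ rowBlock row
    block≡ = ℕₚ.m+[n∸m]≡n (ℕₚ.≮⇒≥ b≮m)
    blockCount≡ : ∀ n → n + suc (n + 0) ≡ suc n + n
    blockCount≡ = ℕSolver.solve-∀
    g<m′ : rowBlock row ∸ m < m′
    g<m′ = ℕₚ.+-cancelˡ-< m _ m′
      (subst₂ _<_ (sym block≡) (blockCount≡ m′) (Finₚ.toℕ<n (proj₁ (remQuot {2 * m ∸ 1} 2 row))))

  barycenter-TU-after-removing-rows : TUAfterRemovingRedundantRows A
  barycenter-TU-after-removing-rows = K , kept , kept-increasing , removed-row-redundant , keptMatrix-TU

theorem3p6 : (m : ℕ) → 3 ≤ m → TUAfterRemovingRedundantRows (barycenterMatrix m 2)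
theorem3p6 (suc m′) _ = KeptRows.barycenter-TU-after-removing-rows m′
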